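{- Let $Z$ be an internal predicate, $k\in\mathbb Z$ and $z\in\mathcal L_k$. Let $i,j\in\mathbb Z$, $a\in\mathbb A_i$, $x\in\mathcal L_i$, $b\in\mathbb A_j$ with $b\neq a$, $y\in\mathcal L_j$, and suppose $a\#y$. Then $Z[a\mapsto x][b\mapsto y]=Z[b\mapsto y][a\mapsto x[b\mapsto y]]$ and $z[a\mapsto x][b\mapsto y]=z[b\mapsto y][a\mapsto x[b\mapsto y]]$.
   Context: Atoms: for each $i\in\mathbb Z$ a set $\mathbb A_i$ of atoms (pairwise disjoint, each of cardinality $\beth_\omega$); $\mathrm{level}(a)=i$ iff $a\in\mathbb A_i$. $(a\,b)$ swaps two atoms of equal level. Internal syntax (binders $[a]$ up to $\alpha$-equivalence): internal predicates are $\wedge(\mathcal X)$ ($\mathcal X$ finite set of internal predicates), $\neg X$, $\forall[a]X$, and $\in(x,a)$ with $a\in\mathbb A_{i+1}$, $x\in\mathcal L_i$; internal sets of level $i$ ($\mathcal L_i$) are $\mathrm{atm}(a)$ ($a\in\mathbb A_i$) and $[a]X$ ($a\in\mathbb A_{i-1}$). $a\#Z$ means $a$ is not free in $Z$. Substitution $Z[a\mapsto x]$ for $a\in\mathbb A_i$, $x\in\mathcal L_i$ (a well-defined operation on internal syntax, preserving sorts and levels): $\wedge(\mathcal X)[a\mapsto x]=\wedge\{X[a\mapsto x]:X\in\mathcal X\}$; $(\neg X)[a\mapsto x]=\neg(X[a\mapsto x])$; $(\forall[b]X)[a\mapsto x]=\forall[b](X[a\mapsto x])$ for $b\#x$; $\in(y,a)[a\mapsto\mathrm{atm}(n)]=\in(y[a\mapsto\mathrm{atm}(n)],n)$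 for any $n\in\mathbb A_i$; $\in(y,a)[a\mapsto[a']X]=X[a'\mapsto y[a\mapsto[a']X]]$ ($a'\in\mathbb A_{i-1}$ fresh); $\in(y,b)[a\mapsto x]=\in(y[a\mapsto x],b)$ for $b\ne a$; $\mathrm{atm}(a)[a\mapsto x]=x$; $\mathrm{atm}(b)[a\mapsto x]=\mathrm{atm}(b)$ for $b\ne a$; $([c]X)[a\mapsto x]=[c](X[a\mapsto x])$ for $c\#x$. -}

module Defs where

-- Internal syntax of the paper, in de Bruijn / locally-nameless form:
--  * free atoms are named: the atom (i , n) is the n-th atom of level i;
--  * bound atoms are de Bruijn indices into a context (a list of levels),
--    so alpha-equivalent terms are literally equal (_≡_).
-- Levels are integers; "i - 1" is written  pred i .

open import Data.Integer using (ℤ; pred) renaming (_≟_ to _≟ℤ_)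
open import Data.Nat using (ℕ; zero; suc; _+_) renaming (_≟_ to _≟ℕ_)
open import Data.List using (List; []; _∷_)
open import Data.List.Membership.Propositional using (_∈_)
open import Data.List.Relation.Unary.Any using (here; there)
open import Data.Product using (_×_; _,_; proj₁)
open import Data.Unit using (⊤)
open import Relation.Binary.PropositionalEquality using (_≡_; refl; sym; subst)
open import Relation.Nullary using (yes; no; ¬_)

Atom : Set
Atom = ℤ × ℕ

level : Atom → ℤ
level = proj₁

-- A context of bound atoms (their levels, innermost first).
Ctx : Set
Ctx = List ℤ

data Var (Γ : Ctx) (i : ℤ) : Set where
  free  : ℕ → Var Γ i
  bound : i ∈ Γ → Var Γ i

mutual
  data Pred (Γ : Ctx) : Set where
    and : List (Pred Γ) → Pred Γ
    neg : Pred Γ → Pred Γ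
    all : (j : ℤ) → Pred (j ∷ Γ) → Pred Γ            -- ∀[a]X, a of level j
    mem : {i : ℤ} → Tm Γ (pred i) → Var Γ i → Pred Γ -- ∈(x , a), a of level i, x ∈ L_(i-1)

  data Tm (Γ : Ctx) : ℤ → Set where
    atm : {i : ℤ} → Var Γ i → Tm Γ i
    lam : {i : ℤ} → Pred (pred i ∷ Γ) → Tm Γ i       -- [a]X, a of level i - 1

-- Closed (paper-level) predicates and sets: no dangling bound atoms.
IPred : Set
IPred = Pred []

𝓛 : ℤ → Set
𝓛 i = Tm [] i

Ren : Ctx → Ctx → Set
Ren Γ Δ = ∀ {i} → i ∈ Γ → i ∈ Δ

liftR : ∀ {Γ Δ j} → Ren Γ Δ → Ren (j ∷ Γ) (j ∷ Δ)
liftR ρ (here p)  = here p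
liftR ρ (there p) = there (ρ p)

renV : ∀ {Γ Δ i} → Ren Γ Δ → Var Γ i → Var Δ i
renV ρ (free n)  = free n
renV ρ (bound p) = bound (ρ p)

mutual
  renP : ∀ {Γ Δ} → Ren Γ Δ → Pred Γ → Pred Δ
  renP ρ (and Xs)  = and (renL ρ Xs)
  renP ρ (neg X)   = neg (renP ρ X)
  renP ρ (all j X) = all j (renP (liftR ρ) X)
  renP ρ (mem y v) = mem (renT ρ y) (renV ρ v)

  renL : ∀ {Γ Δ} → Ren Γ Δ → List (Pred Γ) → List (Pred Δ)
  renL ρ []       = []
  renL ρ (X ∷ Xs) = renP ρ X ∷ renL ρ Xs

  renT : ∀ {Γ Δ i} → Ren Γ Δ → Tm Γ i → Tm Δ i
  renT ρ (atm v) = atm (renV ρ v)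
  renT ρ (lam X) = lam (renP (liftR ρ) X)

weakenT : ∀ {Δ j i} → Tm Δ i → Tm (j ∷ Δ) i
weakenT = renT there

Sub : Ctx → Ctx → Set
Sub Γ Δ = ∀ {i} → Var Γ i → Tm Δ i

liftS : ∀ {Γ Δ j} → Sub Γ Δ → Sub (j ∷ Γ) (j ∷ Δ)
liftS σ (free n)          = weakenT (σ (free n))
liftS σ (bound (here p))  = atm (bound (here p))
liftS σ (bound (there p)) = weakenT (σ (bound p))

inst : ∀ {Δ j} → Tm Δ j → Sub (j ∷ Δ) Δ
inst t (free n)          = atm (free n)
inst t (bound (here p))  = subst (Tm _) (sym p) t
inst t (bound (there p)) = atm (bound p)

-- The first argument is fuel, consumed only by the non-structural clause
--   ∈(y,a)[a ↦ [a']X] = X[a' ↦ y[a ↦ [a']X]].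
-- The substitution operations below supply enough fuel.
mutual
  subP : ∀ {Γ Δ} → ℕ → Sub Γ Δ → Pred Γ → Pred Δ
  subP n σ (and Xs)  = and (subL n σ Xs)
  subP n σ (neg X)   = neg (subP n σ X)
  subP n σ (all j X) = all j (subP n (liftS σ) X)
  subP n σ (mem y v) = subMem n (subT n σ y) (σ v)

  subMem : ∀ {Δ i} → ℕ → Tm Δ (pred i) → Tm Δ i → Pred Δ
  subMem n       y' (atm w) = mem y' w
  subMem zero    y' (lam X) = and []          -- unreachable with enough fuel
  subMem (suc n) y' (lam X) = subP n (inst y') X

  subL : ∀ {Γ Δ} → ℕ → Sub Γ Δ → List (Pred Γ) → List (Pred Δ)
  subL n σ []       = []
  subL n σ (X ∷ Xs) = subP n σ X ∷ subL n σ Xs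

  subT : ∀ {Γ Δ i} → ℕ → Sub Γ Δ → Tm Γ i → Tm Δ i
  subT n σ (atm v) = σ v
  subT n σ (lam X) = lam (subP n (liftS σ) X)

single : (a : Atom) → 𝓛 (level a) → Sub [] []
single (i , n) x {k} (free m) with k ≟ℤ i | m ≟ℕ n
... | yes refl | yes _ = x
... | _        | _     = atm (free m)

mutual
  sizeP : ∀ {Γ} → Pred Γ → ℕ
  sizeP (and Xs)  = suc (sizeL Xs)
  sizeP (neg X)   = suc (sizeP X)
  sizeP (all j X) = suc (sizeP X)
  sizeP (mem y v) = suc (sizeT y)

  sizeL : ∀ {Γ} → List (Pred Γ) → ℕ
  sizeL []       = 0
  sizeL (X ∷ Xs) = sizeP X + sizeL Xs

  sizeT : ∀ {Γ i} → Tm Γ i → ℕ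
  sizeT (atm v) = 1
  sizeT (lam X) = suc (sizeP X)

_[_↦_]P : IPred → (a : Atom) → 𝓛 (level a) → IPred
Z [ a ↦ x ]P = subP (sizeP Z + sizeT x) (single a x) Z

_[_↦_]T : ∀ {k} → 𝓛 k → (a : Atom) → 𝓛 (level a) → 𝓛 k
z [ a ↦ x ]T = subT (sizeT z + sizeT x) (single a x) z

_#V_ : ∀ {Γ i} → Atom → Var Γ i → Set
_#V_ {i = i} a (free m) = ¬ (a ≡ (i , m))
a #V bound p            = ⊤

mutual
  _#P_ : ∀ {Γ} → Atom → Pred Γ → Set
  a #P and Xs  = a #L Xs
  a #P neg X   = a #P X
  a #P all j X = a #P X
  a #P mem y v = (a #T y) × (a #V v)

  _#L_ : ∀ {Γ} → Atom → List (Pred Γ) → Set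
  a #L []       = ⊤
  a #L (X ∷ Xs) = (a #P X) × (a #L Xs)

  _#T_ : ∀ {Γ i} → Atom → Tm Γ i → Set
  a #T atm v = a #V v
  a #T lam X = a #P X

module Submission where

-- In Defs the substitution Z[a ↦ x] is computed with fuel, consumed only
-- by the clause  ∈(y,[a']X) ↦ X[a' ↦ y].  Such a reduction at an
-- abstraction of level i instantiates an atom of level i - 1, so a chain
-- of nested reductions passes through strictly decreasing levels, all
-- among the finitely many levels of abstractions occurring in the data.
--  1. Fuel-independent algebra of renamings and substitutions:
--     congruence, fusion with renamings, identity, weakening.
--  2. For a set S containing every abstraction level, "n units of fuel
--     suffice at level i" (Suffices).  For admissible substitutions extra
--     fuel changes nothing (subP-fuel-≤′), and substituting by a composite
--     is substituting twice (subP-⨾, with the β-clause in subP-subMem).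
--  3. Pigeonhole: fuel at least the number of abstractions suffices at
--     every level, so Z[a ↦ x] equals the substitution at any larger fuel
--     ([↦]P-at-fuel).
--  4. Two single substitutions commute pointwise when b ≠ a and a # y
--     (single-commute).  Evaluating all substitutions of the theorem at one
--     large common fuel, parts 2 and 3 turn this into the theorem.

open import Defs
open import Data.Empty using (⊥-elim)
open import Data.Integer using (ℤ; pred) renaming (_≤_ to _≤ℤ_; _≟_ to _≟ℤ_)
import Data.Integer.Properties as ℤP
open import Data.List using (List; []; _∷_; _++_; length; filter)
open import Data.List.Membership.DecPropositional ℤP._≟_ using (_∈?_)
open import Data.List.Membership.Propositional using (_∈_)
open import Data.List.Membership.Propositional.Properties using (∈-++⁺ˡ; ∈-++⁺ʳ; ∈-filter⁺)
open import Data.List.Properties using (length-++; filter-notAll)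
import Data.List.Relation.Unary.Any as Any
open import Data.List.Relation.Unary.Any using (here; there)
open import Data.Nat using (ℕ; zero; suc; _+_; _≤_; _≤′_; ≤′-reflexive; ≤′-step; z≤n; s≤s)
  renaming (_≟_ to _≟ℕ_)
open import Data.Nat.ListAction using (sum)
import Data.Nat.Properties as ℕP
open import Data.Product using (_×_; _,_; proj₁; proj₂)
open import Data.Product.Properties using (≡-dec)
open import Data.Sum using (_⊎_; inj₁; inj₂)
open import Data.Unit using (⊤; tt)
open import Relation.Binary.PropositionalEquality
open import Relation.Nullary using (¬_; Dec; yes; no; ¬?)

_≗S_ : ∀ {Γ Δ} → Sub Γ Δ → Sub Γ Δ → Set
_≗S_ {Γ} σ τ = ∀ {i} (v : Var Γ i) → σ v ≡ τ v

liftS-cong : ∀ {Γ Δ j} {σ τ : Sub Γ Δ} → σ ≗S τ → liftS {j = j} σ ≗S liftS τ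
liftS-cong e (free n)          = cong weakenT (e (free n))
liftS-cong e (bound (here p))  = refl
liftS-cong e (bound (there p)) = cong weakenT (e (bound p))

mutual
  subP-cong : ∀ {Γ Δ} n {σ τ : Sub Γ Δ} → σ ≗S τ → ∀ X → subP n σ X ≡ subP n τ X
  subP-cong n e (and Xs)  = cong and (subL-cong n e Xs)
  subP-cong n e (neg X)   = cong neg (subP-cong n e X)
  subP-cong n e (all j X) = cong (all j) (subP-cong n (liftS-cong e) X)
  subP-cong n e (mem y v) = cong₂ (subMem n) (subT-cong n e y) (e v)

  subL-cong : ∀ {Γ Δ} n {σ τ : Sub Γ Δ} → σ ≗S τ → ∀ Xs → subL n σ Xs ≡ subL n τ Xs
  subL-cong n e []       = refl
  subL-cong n e (X ∷ Xs) = cong₂ _∷_ (subP-cong n e X) (subL-cong n e Xs)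

  subT-cong : ∀ {Γ Δ i} n {σ τ : Sub Γ Δ} → σ ≗S τ → ∀ (t : Tm Γ i) → subT n σ t ≡ subT n τ t
  subT-cong n e (atm v) = e v
  subT-cong n e (lam X) = cong lam (subP-cong n (liftS-cong e) X)

_≗R_ : ∀ {Γ Δ} → Ren Γ Δ → Ren Γ Δ → Set
_≗R_ {Γ} r s = ∀ {i} (p : i ∈ Γ) → r p ≡ s p

liftR-cong : ∀ {Γ Δ j} {r s : Ren Γ Δ} → r ≗R s → liftR {j = j} r ≗R liftR s
liftR-cong e (here p)  = refl
liftR-cong e (there p) = cong there (e p)

renV-cong : ∀ {Γ Δ i} {r s : Ren Γ Δ} → r ≗R s → (v : Var Γ i) → renV r v ≡ renV s v
renV-cong e (free n)  = refl
renV-cong e (bound p) = cong bound (e p)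

mutual
  renP-cong : ∀ {Γ Δ} {r s : Ren Γ Δ} → r ≗R s → ∀ X → renP r X ≡ renP s X
  renP-cong e (and Xs)  = cong and (renL-cong e Xs)
  renP-cong e (neg X)   = cong neg (renP-cong e X)
  renP-cong e (all j X) = cong (all j) (renP-cong (liftR-cong e) X)
  renP-cong e (mem y v) = cong₂ mem (renT-cong e y) (renV-cong e v)

  renL-cong : ∀ {Γ Δ} {r s : Ren Γ Δ} → r ≗R s → ∀ Xs → renL r Xs ≡ renL s Xs
  renL-cong e []       = refl
  renL-cong e (X ∷ Xs) = cong₂ _∷_ (renP-cong e X) (renL-cong e Xs)

  renT-cong : ∀ {Γ Δ i} {r s : Ren Γ Δ} → r ≗R s → ∀ (t : Tm Γ i) → renT r t ≡ renT s t
  renT-cong e (atm v) = cong atm (renV-cong e v)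
  renT-cong e (lam X) = cong lam (renP-cong (liftR-cong e) X)

_∘R_ : ∀ {Γ Δ Θ} → Ren Δ Θ → Ren Γ Δ → Ren Γ Θ
(r ∘R s) p = r (s p)

liftR-∘ : ∀ {Γ Δ Θ j} (r : Ren Δ Θ) (s : Ren Γ Δ) → (liftR {j = j} r ∘R liftR s) ≗R liftR (r ∘R s)
liftR-∘ r s (here p)  = refl
liftR-∘ r s (there p) = refl

renV-∘ : ∀ {Γ Δ Θ i} (r : Ren Δ Θ) (s : Ren Γ Δ) (v : Var Γ i) → renV r (renV s v) ≡ renV (r ∘R s) v
renV-∘ r s (free n)  = refl
renV-∘ r s (bound p) = refl

mutual
  renP-∘ : ∀ {Γ Δ Θ} (r : Ren Δ Θ) (s : Ren Γ Δ) X → renP r (renP s X) ≡ renP (r ∘R s) X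
  renP-∘ r s (and Xs)  = cong and (renL-∘ r s Xs)
  renP-∘ r s (neg X)   = cong neg (renP-∘ r s X)
  renP-∘ r s (all j X) = cong (all j) (trans (renP-∘ (liftR r) (liftR s) X) (renP-cong (liftR-∘ r s) X))
  renP-∘ r s (mem y v) = cong₂ mem (renT-∘ r s y) (renV-∘ r s v)

  renL-∘ : ∀ {Γ Δ Θ} (r : Ren Δ Θ) (s : Ren Γ Δ) Xs → renL r (renL s Xs) ≡ renL (r ∘R s) Xs
  renL-∘ r s []       = refl
  renL-∘ r s (X ∷ Xs) = cong₂ _∷_ (renP-∘ r s X) (renL-∘ r s Xs)

  renT-∘ : ∀ {Γ Δ Θ i} (r : Ren Δ Θ) (s : Ren Γ Δ) (t : Tm Γ i) → renT r (renT s t) ≡ renT (r ∘R s) t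
  renT-∘ r s (atm v) = cong atm (renV-∘ r s v)
  renT-∘ r s (lam X) = cong lam (trans (renP-∘ (liftR r) (liftR s) X) (renP-cong (liftR-∘ r s) X))

-- Substituting into a renamed term is substituting by the precomposite
-- (for every fuel: renaming never creates or destroys a reduction).
_S∘R_ : ∀ {Γ Δ Θ} → Sub Δ Θ → Ren Γ Δ → Sub Γ Θ
(σ S∘R r) v = σ (renV r v)

liftS-S∘R : ∀ {Γ Δ Θ j} (σ : Sub Δ Θ) (r : Ren Γ Δ) → (liftS {j = j} σ S∘R liftR r) ≗S liftS (σ S∘R r)
liftS-S∘R σ r (free n)          = refl
liftS-S∘R σ r (bound (here p))  = refl
liftS-S∘R σ r (bound (there p)) = refl

mutual
  subP-renP : ∀ {Γ Δ Θ} n (σ : Sub Δ Θ) (r : Ren Γ Δ) X → subP n σ (renP r X) ≡ subP n (σ S∘R r) X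
  subP-renP n σ r (and Xs)  = cong and (subL-renL n σ r Xs)
  subP-renP n σ r (neg X)   = cong neg (subP-renP n σ r X)
  subP-renP n σ r (all j X) =
    cong (all j) (trans (subP-renP n (liftS σ) (liftR r) X) (subP-cong n (liftS-S∘R σ r) X))
  subP-renP n σ r (mem y v) = cong (λ y' → subMem n y' (σ (renV r v))) (subT-renT n σ r y)

  subL-renL : ∀ {Γ Δ Θ} n (σ : Sub Δ Θ) (r : Ren Γ Δ) Xs → subL n σ (renL r Xs) ≡ subL n (σ S∘R r) Xs
  subL-renL n σ r []       = refl
  subL-renL n σ r (X ∷ Xs) = cong₂ _∷_ (subP-renP n σ r X) (subL-renL n σ r Xs)

  subT-renT : ∀ {Γ Δ Θ i} n (σ : Sub Δ Θ) (r : Ren Γ Δ) (t : Tm Γ i) → subT n σ (renT r t) ≡ subT n (σ S∘R r) t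
  subT-renT n σ r (atm v) = refl
  subT-renT n σ r (lam X) =
    cong lam (trans (subP-renP n (liftS σ) (liftR r) X) (subP-cong n (liftS-S∘R σ r) X))

_R∘S_ : ∀ {Γ Δ Θ} → Ren Δ Θ → Sub Γ Δ → Sub Γ Θ
(r R∘S σ) v = renT r (σ v)

liftS-R∘S : ∀ {Γ Δ Θ j} (r : Ren Δ Θ) (σ : Sub Γ Δ) → (liftR {j = j} r R∘S liftS σ) ≗S liftS (r R∘S σ)
liftS-R∘S r σ (free n)          = trans (renT-∘ (liftR r) there (σ (free n))) (sym (renT-∘ there r (σ (free n))))
liftS-R∘S r σ (bound (here p))  = refl
liftS-R∘S r σ (bound (there p)) = trans (renT-∘ (liftR r) there (σ (bound p))) (sym (renT-∘ there r (σ (bound p))))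

inst-renT : ∀ {Δ Θ j} (r : Ren Δ Θ) (y : Tm Δ j) → (r R∘S inst y) ≗S (inst (renT r y) S∘R liftR r)
inst-renT r y (free m)            = refl
inst-renT r y (bound (here refl)) = refl
inst-renT r y (bound (there p))   = refl

mutual
  renP-subP : ∀ {Γ Δ Θ} n (r : Ren Δ Θ) (σ : Sub Γ Δ) X → renP r (subP n σ X) ≡ subP n (r R∘S σ) X
  renP-subP n r σ (and Xs)  = cong and (renL-subL n r σ Xs)
  renP-subP n r σ (neg X)   = cong neg (renP-subP n r σ X)
  renP-subP n r σ (all j X) =
    cong (all j) (trans (renP-subP n (liftR r) (liftS σ) X) (subP-cong n (liftS-R∘S r σ) X))
  renP-subP n r σ (mem y v) =
    trans (renP-subMem n r (subT n σ y) (σ v))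
          (cong (λ y' → subMem n y' (renT r (σ v))) (renT-subT n r σ y))

  renL-subL : ∀ {Γ Δ Θ} n (r : Ren Δ Θ) (σ : Sub Γ Δ) Xs → renL r (subL n σ Xs) ≡ subL n (r R∘S σ) Xs
  renL-subL n r σ []       = refl
  renL-subL n r σ (X ∷ Xs) = cong₂ _∷_ (renP-subP n r σ X) (renL-subL n r σ Xs)

  renT-subT : ∀ {Γ Δ Θ i} n (r : Ren Δ Θ) (σ : Sub Γ Δ) (t : Tm Γ i) → renT r (subT n σ t) ≡ subT n (r R∘S σ) t
  renT-subT n r σ (atm v) = refl
  renT-subT n r σ (lam X) =
    cong lam (trans (renP-subP n (liftR r) (liftS σ) X) (subP-cong n (liftS-R∘S r σ) X))

  renP-subMem : ∀ {Δ Θ i} n (r : Ren Δ Θ) (y : Tm Δ (pred i)) (w : Tm Δ i)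
              → renP r (subMem n y w) ≡ subMem n (renT r y) (renT r w)
  renP-subMem n       r y (atm v) = refl
  renP-subMem zero    r y (lam X) = refl
  renP-subMem (suc n) r y (lam X) =
    trans (renP-subP n r (inst y) X)
          (trans (subP-cong n (inst-renT r y) X) (sym (subP-renP n (inst (renT r y)) (liftR r) X)))

idS : ∀ {Γ} → Sub Γ Γ
idS v = atm v

liftS-idS : ∀ {Γ j} → liftS {Γ} {Γ} {j} idS ≗S idS
liftS-idS (free n)          = refl
liftS-idS (bound (here p))  = refl
liftS-idS (bound (there p)) = refl

mutual
  subP-idS : ∀ {Γ} n (X : Pred Γ) → subP n idS X ≡ X
  subP-idS n (and Xs)  = cong and (subL-idS n Xs)
  subP-idS n (neg X)   = cong neg (subP-idS n X)
  subP-idS n (all j X) = cong (all j) (trans (subP-cong n liftS-idS X) (subP-idS n X))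
  subP-idS n (mem y v) = cong (λ y' → mem y' v) (subT-idS n y)

  subL-idS : ∀ {Γ} n (Xs : List (Pred Γ)) → subL n idS Xs ≡ Xs
  subL-idS n []       = refl
  subL-idS n (X ∷ Xs) = cong₂ _∷_ (subP-idS n X) (subL-idS n Xs)

  subT-idS : ∀ {Γ i} n (t : Tm Γ i) → subT n idS t ≡ t
  subT-idS n (atm v) = refl
  subT-idS n (lam X) = cong lam (trans (subP-cong n liftS-idS X) (subP-idS n X))

inst-weakenT : ∀ {Δ j i} n (t : Tm Δ j) (u : Tm Δ i) → subT n (inst t) (weakenT u) ≡ u
inst-weakenT n t u = trans (subT-renT n (inst t) there u) (trans (subT-cong n inst-there u) (subT-idS n u))
  where
    inst-there : (inst t S∘R there) ≗S idS
    inst-there (free m)  = refl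
    inst-there (bound p) = refl

liftS-weakenT : ∀ {Δ Θ j i} n (τ : Sub Δ Θ) (u : Tm Δ i)
              → subT n (liftS {j = j} τ) (weakenT u) ≡ weakenT (subT n τ u)
liftS-weakenT n τ u =
  trans (subT-renT n (liftS τ) there u) (trans (subT-cong n liftS-there u) (sym (renT-subT n there τ u)))
  where
    liftS-there : (liftS τ S∘R there) ≗S (there R∘S τ)
    liftS-there (free m)  = refl
    liftS-there (bound p) = refl

_⨾[_]_ : ∀ {Γ Δ Θ} → Sub Γ Δ → ℕ → Sub Δ Θ → Sub Γ Θ
(σ ⨾[ n ] τ) v = subT n τ (σ v)

liftS-⨾ : ∀ {Γ Δ Θ j} n (σ : Sub Γ Δ) (τ : Sub Δ Θ) → (liftS {j = j} σ ⨾[ n ] liftS τ) ≗S liftS (σ ⨾[ n ] τ)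
liftS-⨾ n σ τ (free m)          = liftS-weakenT n τ (σ (free m))
liftS-⨾ n σ τ (bound (here p))  = refl
liftS-⨾ n σ τ (bound (there p)) = liftS-weakenT n τ (σ (bound p))

-- "n units of fuel suffice at level i" for a set S of abstraction levels:
-- one of the levels i, i - 1, …, i - n lies outside S.  A chain of nested
-- reductions starting at an abstraction of level i only visits
-- abstractions of the levels i, i - 1, … in turn, so it stops in time.
Suffices : (ℤ → Set) → ℕ → ℤ → Set
Suffices S zero    i = ¬ S i
Suffices S (suc n) i = ¬ S i ⊎ Suffices S n (pred i)

Suffices-suc : ∀ {S} n i → Suffices S n i → Suffices S (suc n) i
Suffices-suc zero    i d        = inj₁ d
Suffices-suc (suc n) i (inj₁ d) = inj₁ d
Suffices-suc (suc n) i (inj₂ d) = inj₂ (Suffices-suc n (pred i) d)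

Suffices-step : ∀ {S} n i → S i → Suffices S (suc n) i → Suffices S n (pred i)
Suffices-step n i s (inj₁ ns) = ⊥-elim (ns s)
Suffices-step n i s (inj₂ d)  = d

module AbstractionLevels (S : ℤ → Set) where

  mutual
    LamsInP : ∀ {Γ} → Pred Γ → Set
    LamsInP (and Xs)  = LamsInL Xs
    LamsInP (neg X)   = LamsInP X
    LamsInP (all j X) = LamsInP X
    LamsInP (mem y v) = LamsInT y

    LamsInL : ∀ {Γ} → List (Pred Γ) → Set
    LamsInL []       = ⊤
    LamsInL (X ∷ Xs) = LamsInP X × LamsInL Xs

    LamsInT : ∀ {Γ i} → Tm Γ i → Set
    LamsInT (atm v)     = ⊤
    LamsInT (lam {i} X) = S i × LamsInP X

  -- n units of fuel suffice for plugging t into a β-clause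
  FuelOK : ∀ {Γ i} → ℕ → Tm Γ i → Set
  FuelOK n (atm v)     = ⊤
  FuelOK n (lam {i} X) = Suffices S n i

  Admissible : ∀ {Γ Δ} → ℕ → Sub Γ Δ → Set
  Admissible {Γ} n σ = ∀ {i} (v : Var Γ i) → LamsInT (σ v) × FuelOK n (σ v)

  mutual
    LamsInP-renP : ∀ {Γ Δ} (r : Ren Γ Δ) X → LamsInP X → LamsInP (renP r X)
    LamsInP-renP r (and Xs)  g = LamsInL-renL r Xs g
    LamsInP-renP r (neg X)   g = LamsInP-renP r X g
    LamsInP-renP r (all j X) g = LamsInP-renP (liftR r) X g
    LamsInP-renP r (mem y v) g = LamsInT-renT r y g

    LamsInL-renL : ∀ {Γ Δ} (r : Ren Γ Δ) Xs → LamsInL Xs → LamsInL (renL r Xs)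
    LamsInL-renL r []       g       = tt
    LamsInL-renL r (X ∷ Xs) (g , h) = LamsInP-renP r X g , LamsInL-renL r Xs h

    LamsInT-renT : ∀ {Γ Δ i} (r : Ren Γ Δ) (t : Tm Γ i) → LamsInT t → LamsInT (renT r t)
    LamsInT-renT r (atm v) g       = tt
    LamsInT-renT r (lam X) (s , g) = s , LamsInP-renP (liftR r) X g

  FuelOK-renT : ∀ {Γ Δ i} n (r : Ren Γ Δ) (t : Tm Γ i) → FuelOK n t → FuelOK n (renT r t)
  FuelOK-renT n r (atm v) d = tt
  FuelOK-renT n r (lam X) d = d

  FuelOK-suc : ∀ {Γ i} n (t : Tm Γ i) → FuelOK n t → FuelOK (suc n) t
  FuelOK-suc n (atm v)     d = tt
  FuelOK-suc n (lam {i} X) d = Suffices-suc n i d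

  FuelOK-at : ∀ {Δ} n i (y : Tm Δ (pred i)) → Suffices S n (pred i) → FuelOK n y
  FuelOK-at n i (atm v) d = tt
  FuelOK-at n i (lam X) d = d

  Admissible-≤′ : ∀ {Γ Δ} {m n} {σ : Sub Γ Δ} → m ≤′ n → Admissible m σ → Admissible n σ
  Admissible-≤′ (≤′-reflexive refl) a = a
  Admissible-≤′ {n = suc n} {σ} (≤′-step le) a v =
    proj₁ (Admissible-≤′ le a v) , FuelOK-suc n (σ v) (proj₂ (Admissible-≤′ le a v))

  Admissible-liftS : ∀ {Γ Δ j} n {σ : Sub Γ Δ} → Admissible n σ → Admissible n (liftS {j = j} σ)
  Admissible-liftS n {σ} a (free m) =
    LamsInT-renT there (σ (free m)) (proj₁ (a (free m))) , FuelOK-renT n there (σ (free m)) (proj₂ (a (free m)))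
  Admissible-liftS n a (bound (here p)) = tt , tt
  Admissible-liftS n {σ} a (bound (there p)) =
    LamsInT-renT there (σ (bound p)) (proj₁ (a (bound p))) , FuelOK-renT n there (σ (bound p)) (proj₂ (a (bound p)))

  Admissible-inst : ∀ {Δ j} n (y : Tm Δ j) → LamsInT y → FuelOK n y → Admissible n (inst y)
  Admissible-inst n y g d (free m)            = tt , tt
  Admissible-inst n y g d (bound (here refl)) = g , d
  Admissible-inst n y g d (bound (there p))   = tt , tt

  mutual
    LamsInP-subP : ∀ {Γ Δ} n (σ : Sub Γ Δ) X → Admissible n σ → LamsInP X → LamsInP (subP n σ X)
    LamsInP-subP n σ (and Xs)  a g = LamsInL-subL n σ Xs a g
    LamsInP-subP n σ (neg X)   a g = LamsInP-subP n σ X a g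
    LamsInP-subP n σ (all j X) a g = LamsInP-subP n (liftS σ) X (Admissible-liftS n a) g
    LamsInP-subP n σ (mem y v) a g =
      LamsInP-subMem n (subT n σ y) (σ v) (LamsInT-subT n σ y a g) (proj₁ (a v)) (proj₂ (a v))

    LamsInL-subL : ∀ {Γ Δ} n (σ : Sub Γ Δ) Xs → Admissible n σ → LamsInL Xs → LamsInL (subL n σ Xs)
    LamsInL-subL n σ []       a g       = tt
    LamsInL-subL n σ (X ∷ Xs) a (g , h) = LamsInP-subP n σ X a g , LamsInL-subL n σ Xs a h

    LamsInT-subT : ∀ {Γ Δ i} n (σ : Sub Γ Δ) (t : Tm Γ i) → Admissible n σ → LamsInT t → LamsInT (subT n σ t)
    LamsInT-subT n σ (atm v) a g       = proj₁ (a v)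
    LamsInT-subT n σ (lam X) a (s , g) = s , LamsInP-subP n (liftS σ) X (Admissible-liftS n a) g

    LamsInP-subMem : ∀ {Δ i} n (y : Tm Δ (pred i)) (w : Tm Δ i)
                   → LamsInT y → LamsInT w → FuelOK n w → LamsInP (subMem n y w)
    LamsInP-subMem n       y (atm u) gy gw d = gy
    LamsInP-subMem zero    y (lam X) gy (s , gx) d = ⊥-elim (d s)
    LamsInP-subMem (suc n) y (lam {i} X) gy (s , gx) d =
      LamsInP-subP n (inst y) X (Admissible-inst n y gy (FuelOK-at n i y (Suffices-step n i s d))) gx

  mutual
    subP-fuel-suc : ∀ {Γ Δ} n (σ : Sub Γ Δ) X → Admissible n σ → LamsInP X → subP n σ X ≡ subP (suc n) σ X
    subP-fuel-suc n σ (and Xs)  a g = cong and (subL-fuel-suc n σ Xs a g)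
    subP-fuel-suc n σ (neg X)   a g = cong neg (subP-fuel-suc n σ X a g)
    subP-fuel-suc n σ (all j X) a g = cong (all j) (subP-fuel-suc n (liftS σ) X (Admissible-liftS n a) g)
    subP-fuel-suc n σ (mem y v) a g =
      trans (subMem-fuel-suc n (subT n σ y) (σ v) (LamsInT-subT n σ y a g) (proj₁ (a v)) (proj₂ (a v)))
            (cong (λ y' → subMem (suc n) y' (σ v)) (subT-fuel-suc n σ y a g))

    subL-fuel-suc : ∀ {Γ Δ} n (σ : Sub Γ Δ) Xs → Admissible n σ → LamsInL Xs → subL n σ Xs ≡ subL (suc n) σ Xs
    subL-fuel-suc n σ []       a g       = refl
    subL-fuel-suc n σ (X ∷ Xs) a (g , h) = cong₂ _∷_ (subP-fuel-suc n σ X a g) (subL-fuel-suc n σ Xs a h)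

    subT-fuel-suc : ∀ {Γ Δ i} n (σ : Sub Γ Δ) (t : Tm Γ i) → Admissible n σ → LamsInT t → subT n σ t ≡ subT (suc n) σ t
    subT-fuel-suc n σ (atm v) a g       = refl
    subT-fuel-suc n σ (lam X) a (s , g) = cong lam (subP-fuel-suc n (liftS σ) X (Admissible-liftS n a) g)

    subMem-fuel-suc : ∀ {Δ i} n (y : Tm Δ (pred i)) (w : Tm Δ i)
                    → LamsInT y → LamsInT w → FuelOK n w → subMem n y w ≡ subMem (suc n) y w
    subMem-fuel-suc n       y (atm u) gy gw d = refl
    subMem-fuel-suc zero    y (lam X) gy (s , gx) d = ⊥-elim (d s)
    subMem-fuel-suc (suc n) y (lam {i} X) gy (s , gx) d =
      subP-fuel-suc n (inst y) X (Admissible-inst n y gy (FuelOK-at n i y (Suffices-step n i s d))) gx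

  subP-fuel-≤′ : ∀ {Γ Δ} {m n} (σ : Sub Γ Δ) X → m ≤′ n → Admissible m σ → LamsInP X → subP m σ X ≡ subP n σ X
  subP-fuel-≤′ σ X (≤′-reflexive refl) a g = refl
  subP-fuel-≤′ {n = suc n} σ X (≤′-step le) a g =
    trans (subP-fuel-≤′ σ X le a g) (subP-fuel-suc n σ X (Admissible-≤′ le a) g)

  subT-fuel-≤′ : ∀ {Γ Δ i} {m n} (σ : Sub Γ Δ) (t : Tm Γ i) → m ≤′ n → Admissible m σ → LamsInT t → subT m σ t ≡ subT n σ t
  subT-fuel-≤′ σ t (≤′-reflexive refl) a g = refl
  subT-fuel-≤′ {n = suc n} σ t (≤′-step le) a g =
    trans (subT-fuel-≤′ σ t le a g) (subT-fuel-suc n σ t (Admissible-≤′ le a) g)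

  -- The fuels p and q that σ and τ need
  -- decrease along the β-clause (subP-subMem) and make the recursion
  -- terminate.
  mutual
    subP-⨾ : ∀ {Γ Δ Θ} p q n (σ : Sub Γ Δ) (τ : Sub Δ Θ) X
           → Admissible p σ → Admissible q τ → Admissible n σ → Admissible n τ → LamsInP X
           → subP n τ (subP n σ X) ≡ subP n (σ ⨾[ n ] τ) X
    subP-⨾ p q n σ τ (and Xs) ap aq an bn g = cong and (subL-⨾ p q n σ τ Xs ap aq an bn g)
    subP-⨾ p q n σ τ (neg X) ap aq an bn g = cong neg (subP-⨾ p q n σ τ X ap aq an bn g)
    subP-⨾ p q n σ τ (all j X) ap aq an bn g =
      cong (all j) (trans (subP-⨾ p q n (liftS σ) (liftS τ) X (Admissible-liftS p ap) (Admissible-liftS q aq)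
                                  (Admissible-liftS n an) (Admissible-liftS n bn) g)
                          (subP-cong n (liftS-⨾ n σ τ) X))
    subP-⨾ p q n σ τ (mem y v) ap aq an bn g =
      trans (subP-subMem q p n τ (subT n σ y) (σ v) aq bn (LamsInT-subT n σ y an g)
                         (proj₁ (ap v)) (proj₂ (ap v)) (proj₂ (an v)))
            (cong (λ z → subMem n z (subT n τ (σ v))) (subT-⨾ p q n σ τ y ap aq an bn g))

    subL-⨾ : ∀ {Γ Δ Θ} p q n (σ : Sub Γ Δ) (τ : Sub Δ Θ) Xs
           → Admissible p σ → Admissible q τ → Admissible n σ → Admissible n τ → LamsInL Xs
           → subL n τ (subL n σ Xs) ≡ subL n (σ ⨾[ n ] τ) Xs
    subL-⨾ p q n σ τ [] ap aq an bn g = refl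
    subL-⨾ p q n σ τ (X ∷ Xs) ap aq an bn (g , h) =
      cong₂ _∷_ (subP-⨾ p q n σ τ X ap aq an bn g) (subL-⨾ p q n σ τ Xs ap aq an bn h)

    subT-⨾ : ∀ {Γ Δ Θ i} p q n (σ : Sub Γ Δ) (τ : Sub Δ Θ) (t : Tm Γ i)
           → Admissible p σ → Admissible q τ → Admissible n σ → Admissible n τ → LamsInT t
           → subT n τ (subT n σ t) ≡ subT n (σ ⨾[ n ] τ) t
    subT-⨾ p q n σ τ (atm v) ap aq an bn g = refl
    subT-⨾ p q n σ τ (lam X) ap aq an bn (s , g) =
      cong lam (trans (subP-⨾ p q n (liftS σ) (liftS τ) X (Admissible-liftS p ap) (Admissible-liftS q aq)
                              (Admissible-liftS n an) (Admissible-liftS n bn) g)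
                      (subP-cong n (liftS-⨾ n σ τ) X))

    -- Substitution commutes with the β-clause: for w = [a']X both sides
    -- are X[a' ↦ y] under τ, which by subP-⨾ (used in both directions)
    -- equals X under τ lifted, then instantiated by y under τ.
    subP-subMem : ∀ {Δ Θ i} q p n (τ : Sub Δ Θ) (y : Tm Δ (pred i)) (w : Tm Δ i)
                → Admissible q τ → Admissible n τ → LamsInT y → LamsInT w → FuelOK p w → FuelOK n w
                → subP n τ (subMem n y w) ≡ subMem n (subT n τ y) (subT n τ w)
    subP-subMem q p n τ y (atm u) aq an gy gw dp dn = refl
    subP-subMem q zero n τ y (lam X) aq an gy (s , gx) dp dn = ⊥-elim (dp s)
    subP-subMem q (suc p) zero τ y (lam X) aq an gy (s , gx) dp dn = ⊥-elim (dn s)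
    subP-subMem {Θ = Θ} q (suc p) (suc n) τ y (lam {i} X) aq an gy (s , gx) dp dn =
      begin
        subP (suc n) τ (subP n (inst y) X)
          ≡⟨ cong (subP (suc n) τ) (subP-fuel-suc n (inst y) X (Admissible-inst n y gy (FuelOK-at n i y dn')) gx) ⟩
        subP (suc n) τ (subP (suc n) (inst y) X)
          ≡⟨ subP-⨾ p q (suc n) (inst y) τ X (Admissible-inst p y gy (FuelOK-at p i y dp')) aq
                    (Admissible-inst (suc n) y gy (FuelOK-at (suc n) i y (Suffices-suc n (pred i) dn'))) an gx ⟩
        subP (suc n) (inst y ⨾[ suc n ] τ) X
          ≡⟨ subP-cong (suc n) inst-then-τ X ⟩
        subP (suc n) (liftS τ ⨾[ suc n ] inst ty) X
          ≡⟨ sym (subP-⨾ q p (suc n) (liftS τ) (inst ty) X (Admissible-liftS q aq)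
                         (Admissible-inst p ty gty (FuelOK-at p i ty dp')) (Admissible-liftS (suc n) an)
                         (Admissible-inst (suc n) ty gty (FuelOK-at (suc n) i ty (Suffices-suc n (pred i) dn'))) gx) ⟩
        subP (suc n) (inst ty) (subP (suc n) (liftS τ) X)
          ≡⟨ sym (subP-fuel-suc n (inst ty) (subP (suc n) (liftS τ) X) (Admissible-inst n ty gty (FuelOK-at n i ty dn'))
                                (LamsInP-subP (suc n) (liftS τ) X (Admissible-liftS (suc n) an) gx)) ⟩
        subP n (inst ty) (subP (suc n) (liftS τ) X)
      ∎
      where
        open ≡-Reasoning
        dn' : Suffices S n (pred i)
        dn' = Suffices-step n i s dn
        dp' : Suffices S p (pred i)
        dp' = Suffices-step p i s dp
        ty : Tm Θ (pred i)
        ty = subT (suc n) τ y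
        gty : LamsInT ty
        gty = LamsInT-subT (suc n) τ y an gy
        inst-then-τ : (inst y ⨾[ suc n ] τ) ≗S (liftS τ ⨾[ suc n ] inst ty)
        inst-then-τ (free m)            = sym (inst-weakenT (suc n) ty (τ (free m)))
        inst-then-τ (bound (here refl)) = refl
        inst-then-τ (bound (there p))   = sym (inst-weakenT (suc n) ty (τ (bound p)))

mutual
  lamLevelsP : ∀ {Γ} → Pred Γ → List ℤ
  lamLevelsP (and Xs)  = lamLevelsL Xs
  lamLevelsP (neg X)   = lamLevelsP X
  lamLevelsP (all j X) = lamLevelsP X
  lamLevelsP (mem y v) = lamLevelsT y

  lamLevelsL : ∀ {Γ} → List (Pred Γ) → List ℤ
  lamLevelsL []       = []
  lamLevelsL (X ∷ Xs) = lamLevelsP X ++ lamLevelsL Xs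

  lamLevelsT : ∀ {Γ i} → Tm Γ i → List ℤ
  lamLevelsT (atm v)     = []
  lamLevelsT (lam {i} X) = i ∷ lamLevelsP X

module _ (S : ℤ → Set) where
  open AbstractionLevels S

  mutual
    LamsInP-lamLevels : ∀ {Γ} (X : Pred Γ) → (∀ {k} → k ∈ lamLevelsP X → S k) → LamsInP X
    LamsInP-lamLevels (and Xs)  h = LamsInL-lamLevels Xs h
    LamsInP-lamLevels (neg X)   h = LamsInP-lamLevels X h
    LamsInP-lamLevels (all j X) h = LamsInP-lamLevels X h
    LamsInP-lamLevels (mem y v) h = LamsInT-lamLevels y h

    LamsInL-lamLevels : ∀ {Γ} (Xs : List (Pred Γ)) → (∀ {k} → k ∈ lamLevelsL Xs → S k) → LamsInL Xs
    LamsInL-lamLevels []       h = tt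
    LamsInL-lamLevels (X ∷ Xs) h =
      LamsInP-lamLevels X (λ m → h (∈-++⁺ˡ m)) , LamsInL-lamLevels Xs (λ m → h (∈-++⁺ʳ (lamLevelsP X) m))

    LamsInT-lamLevels : ∀ {Γ i} (t : Tm Γ i) → (∀ {k} → k ∈ lamLevelsT t → S k) → LamsInT t
    LamsInT-lamLevels (atm v) h = tt
    LamsInT-lamLevels (lam X) h = h (here refl) , LamsInP-lamLevels X (λ m → h (there m))

mutual
  length-lamLevelsP : ∀ {Γ} (X : Pred Γ) → length (lamLevelsP X) ≤ sizeP X
  length-lamLevelsP (and Xs)  = ℕP.m≤n⇒m≤1+n (length-lamLevelsL Xs)
  length-lamLevelsP (neg X)   = ℕP.m≤n⇒m≤1+n (length-lamLevelsP X)
  length-lamLevelsP (all j X) = ℕP.m≤n⇒m≤1+n (length-lamLevelsP X)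
  length-lamLevelsP (mem y v) = ℕP.m≤n⇒m≤1+n (length-lamLevelsT y)

  length-lamLevelsL : ∀ {Γ} (Xs : List (Pred Γ)) → length (lamLevelsL Xs) ≤ sizeL Xs
  length-lamLevelsL []       = z≤n
  length-lamLevelsL (X ∷ Xs) =
    ℕP.≤-trans (ℕP.≤-reflexive (length-++ (lamLevelsP X)))
               (ℕP.+-mono-≤ (length-lamLevelsP X) (length-lamLevelsL Xs))

  length-lamLevelsT : ∀ {Γ i} (t : Tm Γ i) → length (lamLevelsT t) ≤ sizeT t
  length-lamLevelsT (atm v) = z≤n
  length-lamLevelsT (lam X) = s≤s (length-lamLevelsP X)

Suffices-transfer : ∀ {S S' : ℤ → Set} n j → (∀ k → k ≤ℤ j → S k → S' k) → Suffices S' n j → Suffices S n j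
Suffices-transfer zero    j h d        = λ s → d (h j ℤP.≤-refl s)
Suffices-transfer (suc n) j h (inj₁ d) = inj₁ (λ s → d (h j ℤP.≤-refl s))
Suffices-transfer (suc n) j h (inj₂ d) =
  inj₂ (Suffices-transfer n (pred j) (λ k k≤ s → h k (ℤP.≤-trans k≤ (ℤP.i≤j⇒pred[i]≤j ℤP.≤-refl)) s) d)

-- Pigeonhole: n units of fuel suffice at every level once n is at least
-- the number of listed levels, since i, i - 1, …, i - n are n + 1
-- distinct integers.  If i is listed, drop it and recurse at level i - 1.
pigeonhole : ∀ (ls : List ℤ) n i → length ls ≤ n → Suffices (_∈ ls) n i
pigeonhole ls n i le with i ∈? ls
pigeonhole ls zero    i le | no i∉ls = i∉ls
pigeonhole ls (suc n) i le | no i∉ls = inj₁ i∉ls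
pigeonhole (_ ∷ _) zero i () | yes (here _)
pigeonhole (_ ∷ _) zero i () | yes (there _)
pigeonhole ls (suc n) i le | yes i∈ls =
  inj₂ (Suffices-transfer n (pred i) below-i (pigeonhole (filter ≢i? ls) n (pred i) shorter))
  where
    ≢i? : (k : ℤ) → Dec (¬ k ≡ i)
    ≢i? k = ¬? (k ℤP.≟ i)
    shorter : length (filter ≢i? ls) ≤ n
    shorter = ℕP.≤-pred (ℕP.≤-trans (filter-notAll ≢i? ls (Any.map (λ eq ne → ne (sym eq)) i∈ls)) le)
    below-i : ∀ k → k ≤ℤ pred i → k ∈ ls → k ∈ filter ≢i? ls
    below-i k k≤ k∈ls = ∈-filter⁺ ≢i? k∈ls (λ eq → ℤP.<-irrefl eq (ℤP.i≤pred[j]⇒i<j k≤))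

single-hit : ∀ i a (t : 𝓛 i) → single (i , a) t {i} (free a) ≡ t
single-hit i a t with i ≟ℤ i | a ≟ℕ a
... | yes refl | yes _  = refl
... | yes refl | no a≢a = ⊥-elim (a≢a refl)
... | no i≢i   | _      = ⊥-elim (i≢i refl)

single-miss : ∀ i a (t : 𝓛 i) k m → (k , m) ≢ (i , a) → single (i , a) t {k} (free m) ≡ atm (free m)
single-miss i a t k m ne with k ≟ℤ i | m ≟ℕ a
... | yes refl | yes refl = ⊥-elim (ne refl)
... | yes refl | no _     = refl
... | no _     | _        = refl

module _ (S : ℤ → Set) where
  open AbstractionLevels S

  single-admissible : ∀ n (a : Atom) (t : 𝓛 (level a)) → LamsInT t → (∀ k → Suffices S n k)
                    → Admissible n (single a t)
  single-admissible n (i , a) t g enough {k} (free m) with k ≟ℤ i | m ≟ℕ a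
  ... | yes refl | yes _ = g , fuelOK t
    where
      fuelOK : ∀ {Γ l} (u : Tm Γ l) → FuelOK n u
      fuelOK (atm v)     = tt
      fuelOK (lam {l} X) = enough l
  ... | yes refl | no _ = tt , tt
  ... | no _     | _    = tt , tt

-- Z[a ↦ t] agrees with the substitution at any larger fuel: its own fuel
-- bounds the number of abstractions, so it suffices by pigeonhole.
[↦]P-at-fuel : (X : IPred) (a : Atom) (t : 𝓛 (level a)) (N : ℕ) → sizeP X + sizeT t ≤ N
             → X [ a ↦ t ]P ≡ subP N (single a t) X
[↦]P-at-fuel X a t N le =
  subP-fuel-≤′ (single a t) X (ℕP.≤⇒≤′ le)
    (single-admissible S (sizeP X + sizeT t) a t
       (LamsInT-lamLevels S t (λ m → ∈-++⁺ʳ (lamLevelsP X) m))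
       (λ k → pigeonhole ls _ k (ℕP.≤-trans (ℕP.≤-reflexive (length-++ (lamLevelsP X)))
                                            (ℕP.+-mono-≤ (length-lamLevelsP X) (length-lamLevelsT t)))))
    (LamsInP-lamLevels S X ∈-++⁺ˡ)
  where
    ls : List ℤ
    ls = lamLevelsP X ++ lamLevelsT t
    S : ℤ → Set
    S k = k ∈ ls
    open AbstractionLevels S

[↦]T-at-fuel : ∀ {k} (X : 𝓛 k) (a : Atom) (t : 𝓛 (level a)) (N : ℕ) → sizeT X + sizeT t ≤ N
             → X [ a ↦ t ]T ≡ subT N (single a t) X
[↦]T-at-fuel X a t N le =
  subT-fuel-≤′ (single a t) X (ℕP.≤⇒≤′ le)
    (single-admissible S (sizeT X + sizeT t) a t
       (LamsInT-lamLevels S t (λ m → ∈-++⁺ʳ (lamLevelsT X) m))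
       (λ k → pigeonhole ls _ k (ℕP.≤-trans (ℕP.≤-reflexive (length-++ (lamLevelsT X)))
                                            (ℕP.+-mono-≤ (length-lamLevelsT X) (length-lamLevelsT t)))))
    (LamsInT-lamLevels S X ∈-++⁺ˡ)
  where
    ls : List ℤ
    ls = lamLevelsT X ++ lamLevelsT t
    S : ℤ → Set
    S k = k ∈ ls
    open AbstractionLevels S

FixesAllBut : ∀ {Γ} → Atom → Sub Γ Γ → Set
FixesAllBut {Γ} a σ = ∀ {i} (v : Var Γ i) → a #V v → σ v ≡ atm v

FixesAllBut-liftS : ∀ {Γ j} a (σ : Sub Γ Γ) → FixesAllBut a σ → FixesAllBut a (liftS {j = j} σ)
FixesAllBut-liftS a σ e (free m)          h = cong weakenT (e (free m) h)
FixesAllBut-liftS a σ e (bound (here p))  h = refl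
FixesAllBut-liftS a σ e (bound (there p)) h = cong weakenT (e (bound p) tt)

mutual
  subP-fresh : ∀ {Γ} n a (σ : Sub Γ Γ) X → FixesAllBut a σ → a #P X → subP n σ X ≡ X
  subP-fresh n a σ (and Xs)  e h = cong and (subL-fresh n a σ Xs e h)
  subP-fresh n a σ (neg X)   e h = cong neg (subP-fresh n a σ X e h)
  subP-fresh n a σ (all j X) e h = cong (all j) (subP-fresh n a (liftS σ) X (FixesAllBut-liftS a σ e) h)
  subP-fresh n a σ (mem y v) e (hy , hv) =
    trans (cong (subMem n (subT n σ y)) (e v hv)) (cong (λ y' → mem y' v) (subT-fresh n a σ y e hy))

  subL-fresh : ∀ {Γ} n a (σ : Sub Γ Γ) Xs → FixesAllBut a σ → a #L Xs → subL n σ Xs ≡ Xs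
  subL-fresh n a σ []       e h        = refl
  subL-fresh n a σ (X ∷ Xs) e (h , h') = cong₂ _∷_ (subP-fresh n a σ X e h) (subL-fresh n a σ Xs e h')

  subT-fresh : ∀ {Γ i} n a (σ : Sub Γ Γ) (t : Tm Γ i) → FixesAllBut a σ → a #T t → subT n σ t ≡ t
  subT-fresh n a σ (atm v) e h = e v h
  subT-fresh n a σ (lam X) e h = cong lam (subP-fresh n a (liftS σ) X (FixesAllBut-liftS a σ e) h)

single-fixesAllBut : ∀ i a (t : 𝓛 i) → FixesAllBut (i , a) (single (i , a) t)
single-fixesAllBut i a t {k} (free m) h = single-miss i a t k m (λ eq → h (sym eq))

module _ (N : ℕ) (i j : ℤ) (a b : ℕ) (x : 𝓛 i) (y : 𝓛 j) where
  private
    sA sB sA' : Sub [] []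
    sA  = single (i , a) x
    sB  = single (j , b) y
    sA' = single (i , a) (subT N sB x)

  single-commute : (j , b) ≢ (i , a) → (i , a) #T y → (sA ⨾[ N ] sB) ≗S (sB ⨾[ N ] sA')
  single-commute b≢a a#y {k} (free m) with ≡-dec _≟ℤ_ _≟ℕ_ (k , m) (i , a)
  ... | yes refl =
    begin
      subT N sB (sA (free a))   ≡⟨ cong (subT N sB) (single-hit i a x) ⟩
      subT N sB x               ≡⟨ sym (single-hit i a (subT N sB x)) ⟩
      sA' (free a)              ≡⟨ cong (subT N sA') (sym (single-miss j b y i a (λ eq → b≢a (sym eq)))) ⟩
      subT N sA' (sB (free a))  ∎
    where open ≡-Reasoning
  ... | no m≢a with ≡-dec _≟ℤ_ _≟ℕ_ (k , m) (j , b)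
  ...   | yes refl =
    begin
      subT N sB (sA (free b))   ≡⟨ cong (subT N sB) (single-miss i a x j b m≢a) ⟩
      sB (free b)               ≡⟨ single-hit j b y ⟩
      y                         ≡⟨ sym (subT-fresh N (i , a) sA' y (single-fixesAllBut i a _) a#y) ⟩
      subT N sA' y              ≡⟨ cong (subT N sA') (sym (single-hit j b y)) ⟩
      subT N sA' (sB (free b))  ∎
    where open ≡-Reasoning
  ...   | no m≢b =
    begin
      subT N sB (sA (free m))   ≡⟨ cong (subT N sB) (single-miss i a x k m m≢a) ⟩
      sB (free m)               ≡⟨ single-miss j b y k m m≢b ⟩
      atm (free m)              ≡⟨ sym (single-miss i a _ k m m≢a) ⟩
      sA' (free m)              ≡⟨ cong (subT N sA') (sym (single-miss j b y k m m≢b)) ⟩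
      subT N sA' (sB (free m))  ∎
    where open ≡-Reasoning
  single-commute b≢a a#y (bound ())

module _ (S : ℤ → Set) (N : ℕ) (i j : ℤ) (a b : ℕ) (x : 𝓛 i) (y : 𝓛 j)
         (b≢a : (j , b) ≢ (i , a)) (a#y : (i , a) #T y) (enough : ∀ k → Suffices S N k) where
  open AbstractionLevels S

  private
    sA sB sA' : Sub [] []
    sA  = single (i , a) x
    sB  = single (j , b) y
    sA' = single (i , a) (subT N sB x)

  module _ (gx : LamsInT x) (gy : LamsInT y) where
    private
      adA : Admissible N sA
      adA = single-admissible S N (i , a) x gx enough
      adB : Admissible N sB
      adB = single-admissible S N (j , b) y gy enough
      adA' : Admissible N sA'
      adA' = single-admissible S N (i , a) (subT N sB x) (LamsInT-subT N sB x adB gx) enough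

    subP-singles-commute : (Z : IPred) → LamsInP Z → subP N sB (subP N sA Z) ≡ subP N sA' (subP N sB Z)
    subP-singles-commute Z gZ =
      begin
        subP N sB (subP N sA Z)  ≡⟨ subP-⨾ N N N sA sB Z adA adB adA adB gZ ⟩
        subP N (sA ⨾[ N ] sB) Z  ≡⟨ subP-cong N (single-commute N i j a b x y b≢a a#y) Z ⟩
        subP N (sB ⨾[ N ] sA') Z ≡⟨ sym (subP-⨾ N N N sB sA' Z adB adA' adB adA' gZ) ⟩
        subP N sA' (subP N sB Z) ∎
      where open ≡-Reasoning

    subT-singles-commute : ∀ {k} (z : 𝓛 k) → LamsInT z → subT N sB (subT N sA z) ≡ subT N sA' (subT N sB z)
    subT-singles-commute z gz =
      begin
        subT N sB (subT N sA z)  ≡⟨ subT-⨾ N N N sA sB z adA adB adA adB gz ⟩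
        subT N (sA ⨾[ N ] sB) z  ≡⟨ subT-cong N (single-commute N i j a b x y b≢a a#y) z ⟩
        subT N (sB ⨾[ N ] sA') z ≡⟨ sym (subT-⨾ N N N sB sA' z adB adA' adB adA' gz) ⟩
        subT N sA' (subT N sB z) ∎
      where open ≡-Reasoning

≤-sum : ∀ {n} ns → n ∈ ns → n ≤ sum ns
≤-sum (n ∷ ns) (here refl) = ℕP.m≤m+n n (sum ns)
≤-sum (m ∷ ns) (there p)   = ℕP.≤-trans (≤-sum ns p) (ℕP.m≤n+m (sum ns) m)

-- The predicate half of the theorem: every substitution involved is
-- evaluated at one common fuel N, above all their own fuels and the
-- number of abstraction levels involved; there the orders commute.
[↦]P-commute : (Z : IPred) (i j : ℤ) (a : ℕ) (x : 𝓛 i) (b : ℕ) (y : 𝓛 j)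
             → (j , b) ≢ (i , a) → (i , a) #T y
             → (Z [ (i , a) ↦ x ]P) [ (j , b) ↦ y ]P ≡ (Z [ (j , b) ↦ y ]P) [ (i , a) ↦ (x [ (j , b) ↦ y ]T) ]P
[↦]P-commute Z i j a x b y b≢a a#y =
  begin
    (Z [ A ↦ x ]P) [ B ↦ y ]P
      ≡⟨ [↦]P-at-fuel (Z [ A ↦ x ]P) B y N (≤-sum bounds (there (here refl))) ⟩
    subP N sB (Z [ A ↦ x ]P)
      ≡⟨ cong (subP N sB) ([↦]P-at-fuel Z A x N (≤-sum bounds (here refl))) ⟩
    subP N sB (subP N (single A x) Z)
      ≡⟨ subP-singles-commute S N i j a b x y b≢a a#y enough gx gy Z gZ ⟩
    subP N (single A (subT N sB x)) (subP N sB Z)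
      ≡⟨ sym (cong₂ (λ t W → subP N (single A t) W)
                    ([↦]T-at-fuel x B y N (≤-sum bounds (there (there (there (there (here refl)))))))
                    ([↦]P-at-fuel Z B y N (≤-sum bounds (there (there (here refl)))))) ⟩
    subP N (single A (x [ B ↦ y ]T)) (Z [ B ↦ y ]P)
      ≡⟨ sym ([↦]P-at-fuel (Z [ B ↦ y ]P) A (x [ B ↦ y ]T) N (≤-sum bounds (there (there (there (here refl)))))) ⟩
    (Z [ B ↦ y ]P) [ A ↦ (x [ B ↦ y ]T) ]P
  ∎
  where
    open ≡-Reasoning
    A B : Atom
    A = (i , a)
    B = (j , b)
    sB : Sub [] []
    sB = single B y
    ls : List ℤ
    ls = lamLevelsP Z ++ (lamLevelsT x ++ lamLevelsT y)
    S : ℤ → Set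
    S k = k ∈ ls
    bounds : List ℕ
    bounds = sizeP Z + sizeT x ∷ sizeP (Z [ A ↦ x ]P) + sizeT y ∷ sizeP Z + sizeT y
           ∷ sizeP (Z [ B ↦ y ]P) + sizeT (x [ B ↦ y ]T) ∷ sizeT x + sizeT y ∷ length ls ∷ []
    N : ℕ
    N = sum bounds
    enough : ∀ k → Suffices S N k
    enough k = pigeonhole ls N k (≤-sum bounds (there (there (there (there (there (here refl)))))))
    open AbstractionLevels S
    gZ : LamsInP Z
    gZ = LamsInP-lamLevels S Z ∈-++⁺ˡ
    gx : LamsInT x
    gx = LamsInT-lamLevels S x (λ m → ∈-++⁺ʳ (lamLevelsP Z) (∈-++⁺ˡ m))
    gy : LamsInT y
    gy = LamsInT-lamLevels S y (λ m → ∈-++⁺ʳ (lamLevelsP Z) (∈-++⁺ʳ (lamLevelsT x) m))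

[↦]T-commute : ∀ {k} (z : 𝓛 k) (i j : ℤ) (a : ℕ) (x : 𝓛 i) (b : ℕ) (y : 𝓛 j)
             → (j , b) ≢ (i , a) → (i , a) #T y
             → (z [ (i , a) ↦ x ]T) [ (j , b) ↦ y ]T ≡ (z [ (j , b) ↦ y ]T) [ (i , a) ↦ (x [ (j , b) ↦ y ]T) ]T
[↦]T-commute z i j a x b y b≢a a#y =
  begin
    (z [ A ↦ x ]T) [ B ↦ y ]T
      ≡⟨ [↦]T-at-fuel (z [ A ↦ x ]T) B y N (≤-sum bounds (there (here refl))) ⟩
    subT N sB (z [ A ↦ x ]T)
      ≡⟨ cong (subT N sB) ([↦]T-at-fuel z A x N (≤-sum bounds (here refl))) ⟩
    subT N sB (subT N (single A x) z)
      ≡⟨ subT-singles-commute S N i j a b x y b≢a a#y enough gx gy z gz ⟩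
    subT N (single A (subT N sB x)) (subT N sB z)
      ≡⟨ sym (cong₂ (λ t w → subT N (single A t) w)
                    ([↦]T-at-fuel x B y N (≤-sum bounds (there (there (there (there (here refl)))))))
                    ([↦]T-at-fuel z B y N (≤-sum bounds (there (there (here refl)))))) ⟩
    subT N (single A (x [ B ↦ y ]T)) (z [ B ↦ y ]T)
      ≡⟨ sym ([↦]T-at-fuel (z [ B ↦ y ]T) A (x [ B ↦ y ]T) N (≤-sum bounds (there (there (there (here refl)))))) ⟩
    (z [ B ↦ y ]T) [ A ↦ (x [ B ↦ y ]T) ]T
  ∎
  where
    open ≡-Reasoning
    A B : Atom
    A = (i , a)
    B = (j , b)
    sB : Sub [] []
    sB = single B y
    ls : List ℤ
    ls = lamLevelsT z ++ (lamLevelsT x ++ lamLevelsT y)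
    S : ℤ → Set
    S k = k ∈ ls
    bounds : List ℕ
    bounds = sizeT z + sizeT x ∷ sizeT (z [ A ↦ x ]T) + sizeT y ∷ sizeT z + sizeT y
           ∷ sizeT (z [ B ↦ y ]T) + sizeT (x [ B ↦ y ]T) ∷ sizeT x + sizeT y ∷ length ls ∷ []
    N : ℕ
    N = sum bounds
    enough : ∀ k → Suffices S N k
    enough k = pigeonhole ls N k (≤-sum bounds (there (there (there (there (there (here refl)))))))
    open AbstractionLevels S
    gz : LamsInT z
    gz = LamsInT-lamLevels S z ∈-++⁺ˡ
    gx : LamsInT x
    gx = LamsInT-lamLevels S x (λ m → ∈-++⁺ʳ (lamLevelsT z) (∈-++⁺ˡ m))
    gy : LamsInT y
    gy = LamsInT-lamLevels S y (λ m → ∈-++⁺ʳ (lamLevelsT z) (∈-++⁺ʳ (lamLevelsT x) m))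

lemma4p12 : (Z : IPred) (k : ℤ) (z : 𝓛 k)
    (i j : ℤ) (a : ℕ) (x : 𝓛 i) (b : ℕ) (y : 𝓛 j)
    → (j , b) ≢ (i , a)
    → (i , a) #T y
    → ((Z [ (i , a) ↦ x ]P) [ (j , b) ↦ y ]P
         ≡ (Z [ (j , b) ↦ y ]P) [ (i , a) ↦ (x [ (j , b) ↦ y ]T) ]P)
      × ((z [ (i , a) ↦ x ]T) [ (j , b) ↦ y ]T
         ≡ (z [ (j , b) ↦ y ]T) [ (i , a) ↦ (x [ (j , b) ↦ y ]T) ]T)
lemma4p12 Z k z i j a x b y b≢a a#y =
  [↦]P-commute Z i j a x b y b≢a a#y , [↦]T-commute z i j a x b y b≢a a#y
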